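{- Let $\Sigma$ be an alphabet, $\#\notin\Sigma$, let $y_1,\ldots,y_N$ be words over $\Sigma$ with $N>1$, let $\ell$ be a positive integer, and let $x\in\mathcal{M}^{\ell}_{y_1\#\ldots\#y_N}$. Then either $x\in\mathcal{M}^{\ell}_{y_1\#\ldots\#y_{N-1}}\cup\mathcal{M}^{\ell}_{y_N}$, or otherwise $x\in\mathcal{M}^{\ell}_{y_i\#y_N}\setminus(\mathcal{M}^{\ell}_{y_i}\cup\mathcal{M}^{\ell}_{y_N})$ for some $i\in\{1,\ldots,N-1\}$. Moreover, in this latter case, either $x$ has a prefix in $\mathcal{RM}^{\ell}_{y_1\#\ldots\#y_{N-1}}$ and a suffix in $\mathcal{RM}^{\ell}_{y_N}$, or $x$ has a prefix in $\mathcal{RM}^{\ell}_{y_N}$ and a suffix in $\mathcal{RM}^{\ell}_{y_1\#\ldots\#y_{N-1}}$.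
   Context: For a word $y$ over $\Sigma\cup\{\#\}$, the set of minimal absent words of $y$ is $\mathcal{M}_y=\{aub : a,b\in\Sigma,\ u\in\Sigma^*,\ au \text{ and } ub \text{ are factors of } y \text{ but } aub \text{ is not}\}\cup\{c\in\Sigma : c \text{ does not occur in } y\}$. For $\ell>0$, $\mathcal{M}^{\ell}_y=\mathcal{M}_y\cap\Sigma^{\le \ell}$, where $\Sigma^{\le\ell}$ is the set of words over $\Sigma$ of length at most $\ell$. A word $w$ is a superword of $x$ if $x$ is a factor of $w$. Writing $Y=y_1\#\ldots\#y_{N-1}$, the reduced set $\mathcal{RM}^{\ell}_{Y}$ is obtained from $\mathcal{M}^{\ell}_{Y}$ by removing the words that are superwords of some word in $\mathcal{M}^{\ell}_{y_N}$, and $\mathcal{RM}^{\ell}_{y_N}$ is obtained from $\mathcal{M}^{\ell}_{y_N}$ by removing the words that are superwords of some word in $\mathcal{M}^{\ell}_{Y}$. -}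

module Defs where

open import Data.List using (List; []; _∷_; _++_; [_]; map; intercalate; length)
open import Data.Nat using (ℕ; _≤_)
open import Data.Product using (Σ; ∃; ∃-syntax; _×_; _,_)
open import Data.Sum using (_⊎_)
open import Relation.Nullary using (¬_)
open import Relation.Binary.PropositionalEquality using (_≡_)

data Letter (A : Set) : Set where
  ⟨_⟩ : A → Letter A
  #   : Letter A

lift : {A : Set} → List A → List (Letter A)
lift = map ⟨_⟩

join : {A : Set} → List (List A) → List (Letter A)
join ys = intercalate [ # ] (map lift ys)

Factor : {B : Set} → List B → List B → Set
Factor u w = ∃[ p ] ∃[ s ] (p ++ u ++ s ≡ w)

Prefix : {B : Set} → List B → List B → Set
Prefix p w = ∃[ s ] (p ++ s ≡ w)

Suffix : {B : Set} → List B → List B → Set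
Suffix s w = ∃[ p ] (p ++ s ≡ w)

FactorOf : {A : Set} → List A → List (Letter A) → Set
FactorOf u y = Factor (lift u) y

MAW : {A : Set} → List (Letter A) → List A → Set
MAW {A} y w =
  (Σ A λ a → Σ A λ b → Σ (List A) λ u →
     (w ≡ a ∷ u ++ [ b ]) × FactorOf (a ∷ u) y × FactorOf (u ++ [ b ]) y × ¬ FactorOf w y)
  ⊎ (Σ A λ c → (w ≡ [ c ]) × ¬ FactorOf [ c ] y)

MAWℓ : {A : Set} → ℕ → List (Letter A) → List A → Set
MAWℓ ℓ y w = MAW y w × length w ≤ ℓ

RMℓ : {A : Set} → ℕ → List (Letter A) → List (Letter A) → List A → Set
RMℓ ℓ y z w = MAWℓ ℓ y w × ¬ (∃[ v ] (MAWℓ ℓ z v × Factor v w))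

-- If x = a u b is absent from Y # N but au and ub occur in it, then au and ub each lie in Y or in N
-- (a #-free word occurring in l # r occurs in l or in r). Both in the same part makes x minimal
-- absent there; otherwise, say au occurs only in Y and ub only in N, x is minimal absent from
-- yᵢ # N for the yᵢ containing au. Moreover u occurs in N while au does not, so the shortest
-- prefix of au absent from N is a minimal absent word of N; being a factor of au, which occurs
-- in Y, it contains no minimal absent word of Y. Symmetrically for the shortest absent suffix of ub.
module Submission where

open import Defs
open import Data.Empty using (⊥-elim)
open import Data.List using (List; []; _∷_; _∷ʳ_; _++_; [_]; length)
open import Data.List.Membership.Propositional using (_∈_)
open import Data.List.Properties
  using (++-assoc; ++-identityʳ; ++-conicalʳ; map-++; ∷-injective; ∷ʳ-injective)
open import Data.List.Relation.Binary.Infix.Heterogeneous using (Infix; MkView; toView; fromView)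
import Data.List.Relation.Binary.Infix.Heterogeneous.Properties as Infix
open import Data.List.Relation.Binary.Pointwise using (Pointwise-≡⇒≡; ≡⇒Pointwise-≡)
open import Data.List.Relation.Unary.Any using (here; there)
open import Data.List.Reverse using (Reverse; []; _∶_∶ʳ_; reverseView)
open import Data.Nat using (ℕ; _<_; _≤_)
open import Data.Nat.Properties using (≤-trans)
open import Data.Product using (Σ; ∃-syntax; _×_; _,_; proj₁; proj₂)
import Data.Product as Product
open import Data.Sum using (_⊎_; inj₁; inj₂; [_,_]′)
import Data.Sum as Sum
open import Function using (_∘_; case_of_)
open import Relation.Nullary using (¬_; Dec; yes; no; map′)
open import Relation.Binary.Definitions using (DecidableEquality)
open import Relation.Binary.PropositionalEquality
  using (_≡_; _≢_; refl; sym; trans; cong; subst; module ≡-Reasoning)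

private
  variable
    A B : Set
    a b : A
    u v w x : List A
    l r z z₁ z₂ : List (Letter A)

Factor⇒Infix : Factor u w → Infix _≡_ u w
Factor⇒Infix (p , s , refl) = fromView (MkView p (≡⇒Pointwise-≡ refl) s)

Infix⇒Factor : Infix _≡_ u w → Factor u w
Infix⇒Factor i with MkView p u≈v s ← toView i = p , s , cong (λ v → p ++ v ++ s) (Pointwise-≡⇒≡ u≈v)

factor? : DecidableEquality B → (u w : List B) → Dec (Factor u w)
factor? _≟_ u w = map′ Infix⇒Factor Factor⇒Infix (Infix.infix? _≟_ u w)

Factor-trans : Factor u v → Factor v w → Factor u w
Factor-trans f g = Infix⇒Factor (Infix.trans trans (Factor⇒Infix f) (Factor⇒Infix g))

Factor-length : Factor u w → length u ≤ length w
Factor-length = Infix.length-mono ∘ Factor⇒Infix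

Prefix⇒Factor : Prefix u w → Factor u w
Prefix⇒Factor (s , e) = [] , s , e

Suffix⇒Factor : Suffix u w → Factor u w
Suffix⇒Factor {u = u} (p , e) = p , [] , trans (cong (p ++_) (++-identityʳ u)) e

Prefix-++ʳ : Prefix u w → Prefix u (w ++ v)
Prefix-++ʳ {u = u} {v = v} (s , refl) = s ++ v , sym (++-assoc u s v)

Suffix-++ˡ : (v : List B) → Suffix u w → Suffix u (v ++ w)
Suffix-++ˡ {u = u} v (p , refl) = v ++ p , ++-assoc v p u

Factor-sepˡ : (l r : List (Letter A)) → Factor l (l ++ # ∷ r)
Factor-sepˡ l r = [] , # ∷ r , refl

Factor-sepʳ : (l r : List (Letter A)) → Factor r (l ++ # ∷ r)
Factor-sepʳ l r = Factor-trans (Suffix⇒Factor ([ # ] , refl)) (Suffix⇒Factor (l , refl))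

lift-Factor : Factor u w → FactorOf u (lift w)
lift-Factor {u = u} (p , s , refl) =
  lift p , lift s , trans (cong (lift p ++_) (sym (map-++ ⟨_⟩ u s))) (sym (map-++ ⟨_⟩ p (u ++ s)))

FactorOf-trans : Factor u w → FactorOf w z → FactorOf u z
FactorOf-trans = Factor-trans ∘ lift-Factor

Prefix-sep⁻ : (u : List A) {s : List (Letter A)} → lift u ++ s ≡ l ++ # ∷ r → Prefix (lift u) l
Prefix-sep⁻ {l = l} [] _ = l , refl
Prefix-sep⁻ {l = _ ∷ _} (c ∷ u) eq with refl , eq′ ← ∷-injective eq =
  let s , e = Prefix-sep⁻ u eq′ in s , cong (⟨ c ⟩ ∷_) e

FactorOf-sep⁻ : (u : List A) (l : List (Letter A)) →
  FactorOf u (l ++ # ∷ r) → FactorOf u l ⊎ FactorOf u r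
FactorOf-sep⁻ u l ([] , s , eq) = inj₁ (Prefix⇒Factor (Prefix-sep⁻ u eq))
FactorOf-sep⁻ u [] (_ ∷ p , s , eq) with refl , eq′ ← ∷-injective eq = inj₂ (p , s , eq′)
FactorOf-sep⁻ u (c ∷ l) (_ ∷ p , s , eq) with refl , eq′ ← ∷-injective eq =
  Sum.map₁ (λ f → Factor-trans f (Suffix⇒Factor ([ c ] , refl))) (FactorOf-sep⁻ u l (p , s , eq′))

¬FactorOf-sep⁺ : ¬ FactorOf w l → ¬ FactorOf w r → ¬ FactorOf w (l ++ # ∷ r)
¬FactorOf-sep⁺ {w = w} {l = l} w∉l w∉r = [ w∉l , w∉r ]′ ∘ FactorOf-sep⁻ w l

¬FactorOf-sep⁻ : (l : List (Letter A)) → ¬ FactorOf w (l ++ # ∷ r) → ¬ FactorOf w l × ¬ FactorOf w r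
¬FactorOf-sep⁻ {r = r} l w∉ =
  (λ w∈l → w∉ (Factor-trans w∈l (Factor-sepˡ l r))) ,
  (λ w∈r → w∉ (Factor-trans w∈r (Factor-sepʳ l r)))

join-∷ʳ : (ys : List (List A)) → ys ≢ [] → (y : List A) → join (ys ∷ʳ y) ≡ join ys ++ # ∷ lift y
join-∷ʳ [] ys≢[] y = ⊥-elim (ys≢[] refl)
join-∷ʳ (y₁ ∷ []) _ y = refl
join-∷ʳ (y₁ ∷ y₂ ∷ ys) _ y = begin
  lift y₁ ++ # ∷ join (y₂ ∷ ys ∷ʳ y)
    ≡⟨ cong (λ t → lift y₁ ++ # ∷ t) (join-∷ʳ (y₂ ∷ ys) (λ ()) y) ⟩
  lift y₁ ++ # ∷ join (y₂ ∷ ys) ++ # ∷ lift y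
    ≡⟨ sym (++-assoc (lift y₁) (# ∷ join (y₂ ∷ ys)) (# ∷ lift y)) ⟩
  (lift y₁ ++ # ∷ join (y₂ ∷ ys)) ++ # ∷ lift y ∎
  where open ≡-Reasoning

join-∈ : {yi : List A} (ys : List (List A)) → yi ∈ ys → Factor (lift yi) (join ys)
join-∈ (y ∷ []) (here refl) = [] , [] , ++-identityʳ (lift y)
join-∈ (y ∷ y′ ∷ ys) (here refl) = Factor-sepˡ (lift y) (join (y′ ∷ ys))
join-∈ (y ∷ y′ ∷ ys) (there yi∈) =
  Factor-trans (join-∈ (y′ ∷ ys) yi∈) (Factor-sepʳ (lift y) (join (y′ ∷ ys)))

FactorOf-[] : FactorOf w [] → w ≡ []
FactorOf-[] {w = []} _ = refl
FactorOf-[] {w = _ ∷ _} ([] , _ , ())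
FactorOf-[] {w = _ ∷ _} (_ ∷ _ , _ , ())

FactorOf-join⁻ : (ys : List (List A)) → w ≢ [] → FactorOf w (join ys) →
  ∃[ yi ] (yi ∈ ys × FactorOf w (lift yi))
FactorOf-join⁻ [] w≢[] f = ⊥-elim (w≢[] (FactorOf-[] f))
FactorOf-join⁻ (y ∷ []) _ f = y , here refl , f
FactorOf-join⁻ {w = w} (y ∷ y′ ∷ ys) w≢[] f =
  [ (λ f′ → y , here refl , f′)
  , Product.map₂ (Product.map₁ there) ∘ FactorOf-join⁻ (y′ ∷ ys) w≢[]
  ]′ (FactorOf-sep⁻ w (lift y) f)

MAW-absent : MAW z w → ¬ FactorOf w z
MAW-absent (inj₁ (_ , _ , _ , refl , _ , _ , w∉)) = w∉
MAW-absent (inj₂ (_ , refl , w∉)) = w∉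

MAW-factors : MAW z (a ∷ u ++ [ b ]) → FactorOf (a ∷ u) z × FactorOf (u ++ [ b ]) z
MAW-factors {u = u} (inj₁ (_ , _ , u′ , eq , au∈ , ub∈ , _)) with refl , eq′ ← ∷-injective eq
  with refl , refl ← ∷ʳ-injective u u′ eq′ = au∈ , ub∈
MAW-factors {u = []} (inj₂ (_ , () , _))
MAW-factors {u = _ ∷ _} (inj₂ (_ , () , _))

-- A word occurring in z₂ contains no minimal absent word of z₂.
RMℓ-intro : {ℓ : ℕ} → MAWℓ ℓ z₁ w → FactorOf w z₂ → RMℓ ℓ z₁ z₂ w
RMℓ-intro w∈M w∈z₂ = w∈M , λ (v , (v∈M , _) , v⊑w) → MAW-absent v∈M (FactorOf-trans v⊑w w∈z₂)

Straddles : List (Letter A) → List (Letter A) → List A → Set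
Straddles {A} z₁ z₂ x = Σ A λ a → Σ A λ b → Σ (List A) λ u → x ≡ a ∷ u ++ [ b ]
  × (FactorOf (a ∷ u) z₁ × ¬ FactorOf (a ∷ u) z₂)
  × (FactorOf (u ++ [ b ]) z₂ × ¬ FactorOf (u ++ [ b ]) z₁)

Straddles-absent : Straddles z₁ z₂ x → ¬ FactorOf x z₁ × ¬ FactorOf x z₂
Straddles-absent (a , b , u , refl , (_ , au∉₂) , (_ , ub∉₁)) =
  ub∉₁ ∘ FactorOf-trans (Suffix⇒Factor ([ a ] , refl)) ,
  au∉₂ ∘ FactorOf-trans (Prefix⇒Factor ([ b ] , refl))

Straddles⇒¬MAW : Straddles z₁ z₂ x → ¬ MAW z₁ x × ¬ MAW z₂ x
Straddles⇒¬MAW (a , b , u , refl , (_ , au∉₂) , (_ , ub∉₁)) =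
  ub∉₁ ∘ proj₂ ∘ MAW-factors , au∉₂ ∘ proj₁ ∘ MAW-factors

Straddles⇒MAW-sep : Straddles l r x ⊎ Straddles r l x → MAW (l ++ # ∷ r) x
Straddles⇒MAW-sep {l = l} {r = r} (inj₁ st@(a , b , u , refl , (au∈l , _) , (ub∈r , _))) =
  let x∉l , x∉r = Straddles-absent st in
  inj₁ (a , b , u , refl , Factor-trans au∈l (Factor-sepˡ l r) , Factor-trans ub∈r (Factor-sepʳ l r) ,
        ¬FactorOf-sep⁺ x∉l x∉r)
Straddles⇒MAW-sep {l = l} {r = r} (inj₂ st@(a , b , u , refl , (au∈r , _) , (ub∈l , _))) =
  let x∉r , x∉l = Straddles-absent st in
  inj₁ (a , b , u , refl , Factor-trans au∈r (Factor-sepʳ l r) , Factor-trans ub∈l (Factor-sepˡ l r) ,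
        ¬FactorOf-sep⁺ x∉l x∉r)

Straddles-joinˡ : (ys : List (List A)) → Straddles (join ys) z x →
  ∃[ yi ] (yi ∈ ys × Straddles (lift yi) z x)
Straddles-joinˡ ys (a , b , u , refl , (au∈ , au∉) , (ub∈ , ub∉)) =
  let yi , yi∈ , au∈yi = FactorOf-join⁻ ys (λ ()) au∈ in
  yi , yi∈ , a , b , u , refl , (au∈yi , au∉) ,
  (ub∈ , ub∉ ∘ λ ub∈yi → Factor-trans ub∈yi (join-∈ ys yi∈))

Straddles-joinʳ : (ys : List (List A)) → Straddles z (join ys) x →
  ∃[ yi ] (yi ∈ ys × Straddles z (lift yi) x)
Straddles-joinʳ ys (a , b , u , refl , (au∈ , au∉) , (ub∈ , ub∉)) =
  let yi , yi∈ , ub∈yi = FactorOf-join⁻ ys (λ e → case ++-conicalʳ u [ b ] e of λ ()) ub∈ in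
  yi , yi∈ , a , b , u , refl , (au∈ , au∉ ∘ λ au∈yi → Factor-trans au∈yi (join-∈ ys yi∈)) ,
  (ub∈yi , ub∉)

module _ {A : Set} (_≟_ : DecidableEquality A) where

  _≟ᴸ_ : DecidableEquality (Letter A)
  ⟨ c ⟩ ≟ᴸ ⟨ d ⟩ = map′ (cong ⟨_⟩) (λ { refl → refl }) (c ≟ d)
  ⟨ _ ⟩ ≟ᴸ #     = no λ ()
  #     ≟ᴸ ⟨ _ ⟩ = no λ ()
  #     ≟ᴸ #     = yes refl

  factorOf? : (u : List A) (z : List (Letter A)) → Dec (FactorOf u z)
  factorOf? u = factor? _≟ᴸ_ (lift u)

  -- The witness is the shortest prefix of a ∷ u absent from z.
  MAW-prefix : {z : List (Letter A)} (a : A) (u : List A) → ¬ FactorOf (a ∷ u) z → FactorOf u z →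
    ∃[ p ] (Prefix p (a ∷ u) × MAW z p)
  MAW-prefix {z} a u = go (reverseView u)
    where
    go : {u : List A} → Reverse u → ¬ FactorOf (a ∷ u) z → FactorOf u z →
      ∃[ p ] (Prefix p (a ∷ u) × MAW z p)
    go [] a∉ _ = [ a ] , ([] , refl) , inj₂ (a , refl , a∉)
    go (v ∶ v′ ∶ʳ c) avc∉ vc∈ with factorOf? (a ∷ v) z
    ... | yes av∈ = a ∷ v ++ [ c ] , ([] , ++-identityʳ _) , inj₁ (a , c , v , refl , av∈ , vc∈ , avc∉)
    ... | no av∉ = Product.map₂ (Product.map₁ Prefix-++ʳ)
                     (go v′ av∉ (FactorOf-trans (Prefix⇒Factor ([ c ] , refl)) vc∈))

  -- The witness is the shortest suffix of u ++ [ b ] absent from z.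
  MAW-suffix : {z : List (Letter A)} (u : List A) (b : A) → ¬ FactorOf (u ++ [ b ]) z → FactorOf u z →
    ∃[ s ] (Suffix s (u ++ [ b ]) × MAW z s)
  MAW-suffix [] b b∉ _ = [ b ] , ([] , refl) , inj₂ (b , refl , b∉)
  MAW-suffix {z} (c ∷ v) b cvb∉ cv∈ with factorOf? (v ++ [ b ]) z
  ... | yes vb∈ = c ∷ v ++ [ b ] , ([] , refl) , inj₁ (c , b , v , refl , cv∈ , vb∈ , cvb∉)
  ... | no vb∉ = Product.map₂ (Product.map₁ (Suffix-++ˡ [ c ]))
                   (MAW-suffix v b vb∉ (FactorOf-trans (Suffix⇒Factor ([ c ] , refl)) cv∈))

  MAW-or-Straddles : {a b : A} {u : List A} {z₁ z₂ : List (Letter A)} →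
    FactorOf (a ∷ u) z₁ → FactorOf (u ++ [ b ]) z₂ →
    ¬ FactorOf (a ∷ u ++ [ b ]) z₁ → ¬ FactorOf (a ∷ u ++ [ b ]) z₂ →
    (MAW z₁ (a ∷ u ++ [ b ]) ⊎ MAW z₂ (a ∷ u ++ [ b ])) ⊎ Straddles z₁ z₂ (a ∷ u ++ [ b ])
  MAW-or-Straddles {a} {b} {u} {z₁} {z₂} au∈₁ ub∈₂ x∉₁ x∉₂
    with factorOf? (u ++ [ b ]) z₁ | factorOf? (a ∷ u) z₂
  ... | yes ub∈₁ | _       = inj₁ (inj₁ (inj₁ (a , b , u , refl , au∈₁ , ub∈₁ , x∉₁)))
  ... | no _     | yes au∈₂ = inj₁ (inj₂ (inj₁ (a , b , u , refl , au∈₂ , ub∈₂ , x∉₂)))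
  ... | no ub∉₁  | no au∉₂  = inj₂ (a , b , u , refl , (au∈₁ , au∉₂) , (ub∈₂ , ub∉₁))

  MAW-sep-cases : {l r : List (Letter A)} {x : List A} → MAW (l ++ # ∷ r) x →
    (MAW l x ⊎ MAW r x) ⊎ (Straddles l r x ⊎ Straddles r l x)
  MAW-sep-cases {l = l} (inj₂ (c , refl , c∉)) =
    inj₁ (inj₁ (inj₂ (c , refl , proj₁ (¬FactorOf-sep⁻ l c∉))))
  MAW-sep-cases {l = l} (inj₁ (a , b , u , refl , au∈ , ub∈ , x∉))
    with FactorOf-sep⁻ (a ∷ u) l au∈ | FactorOf-sep⁻ (u ++ [ b ]) l ub∈ | ¬FactorOf-sep⁻ l x∉
  ... | inj₁ au∈l | inj₁ ub∈l | x∉l , _   = inj₁ (inj₁ (inj₁ (a , b , u , refl , au∈l , ub∈l , x∉l)))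
  ... | inj₂ au∈r | inj₂ ub∈r | _   , x∉r = inj₁ (inj₂ (inj₁ (a , b , u , refl , au∈r , ub∈r , x∉r)))
  ... | inj₁ au∈l | inj₂ ub∈r | x∉l , x∉r = Sum.map₂ inj₁ (MAW-or-Straddles au∈l ub∈r x∉l x∉r)
  ... | inj₂ au∈r | inj₁ ub∈l | x∉l , x∉r = Sum.map Sum.swap inj₂ (MAW-or-Straddles au∈r ub∈l x∉r x∉l)

  Straddles⇒RMℓ : {ℓ : ℕ} {z₁ z₂ : List (Letter A)} {x : List A} →
    Straddles z₁ z₂ x → length x ≤ ℓ →
    ∃[ p ] (Prefix p x × RMℓ ℓ z₂ z₁ p) × ∃[ s ] (Suffix s x × RMℓ ℓ z₁ z₂ s)
  Straddles⇒RMℓ {ℓ} {z₁} {z₂} (a , b , u , refl , (au∈₁ , au∉₂) , (ub∈₂ , ub∉₁)) |x|≤ℓ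
    with MAW-prefix a u au∉₂ (FactorOf-trans (Prefix⇒Factor ([ b ] , refl)) ub∈₂)
       | MAW-suffix u b ub∉₁ (FactorOf-trans (Suffix⇒Factor ([ a ] , refl)) au∈₁)
  ... | p , p⊑au , p∈M₂ | s , s⊒ub , s∈M₁ =
    p , (p⊑x , RMℓ-intro (p∈M₂ , ≤-trans (Factor-length (Prefix⇒Factor p⊑x)) |x|≤ℓ)
                         (FactorOf-trans (Prefix⇒Factor p⊑au) au∈₁))
      , s , s⊒x , RMℓ-intro (s∈M₁ , ≤-trans (Factor-length (Suffix⇒Factor s⊒x)) |x|≤ℓ)
                            (FactorOf-trans (Suffix⇒Factor s⊒ub) ub∈₂)
    where
    p⊑x : Prefix p (a ∷ u ++ [ b ])
    p⊑x = Prefix-++ʳ p⊑au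
    s⊒x : Suffix s (a ∷ u ++ [ b ])
    s⊒x = Suffix-++ˡ [ a ] s⊒ub

theorem1 : {A : Set} → DecidableEquality A → (enum : List A) → (∀ a → a ∈ enum) →
    (ys : List (List A)) → ys ≢ [] → (yN : List A) → (ℓ : ℕ) → 0 < ℓ →
    (x : List A) → MAWℓ ℓ (join (ys ∷ʳ yN)) x →
    (MAWℓ ℓ (join ys) x ⊎ MAWℓ ℓ (lift yN) x)
    ⊎ (¬ (MAWℓ ℓ (join ys) x ⊎ MAWℓ ℓ (lift yN) x)
       × (∃[ yi ] (yi ∈ ys × MAWℓ ℓ (join (yi ∷ yN ∷ [])) x
                   × ¬ MAWℓ ℓ (lift yi) x × ¬ MAWℓ ℓ (lift yN) x))
       × ((∃[ p ] (Prefix p x × RMℓ ℓ (join ys) (lift yN) p)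
           × ∃[ s ] (Suffix s x × RMℓ ℓ (lift yN) (join ys) s))
          ⊎ (∃[ p ] (Prefix p x × RMℓ ℓ (lift yN) (join ys) p)
           × ∃[ s ] (Suffix s x × RMℓ ℓ (join ys) (lift yN) s))))
theorem1 _≟_ _ _ ys ys≢[] yN ℓ _ x (x∈M , |x|≤ℓ)
  with MAW-sep-cases _≟_ (subst (λ z → MAW z x) (join-∷ʳ ys ys≢[] yN) x∈M)
... | inj₁ x∈MY⊎MN = inj₁ (Sum.map (_, |x|≤ℓ) (_, |x|≤ℓ) x∈MY⊎MN)
... | inj₂ (inj₁ st) =
  let ¬MY , ¬MN = Straddles⇒¬MAW st
      yi , yi∈ , st′ = Straddles-joinˡ ys st
  in inj₂ ( [ ¬MY ∘ proj₁ , ¬MN ∘ proj₁ ]′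
          , (yi , yi∈ , (Straddles⇒MAW-sep (inj₁ st′) , |x|≤ℓ)
                , proj₁ (Straddles⇒¬MAW st′) ∘ proj₁ , ¬MN ∘ proj₁)
          , inj₂ (Straddles⇒RMℓ _≟_ st |x|≤ℓ))
... | inj₂ (inj₂ st) =
  let ¬MN , ¬MY = Straddles⇒¬MAW st
      yi , yi∈ , st′ = Straddles-joinʳ ys st
  in inj₂ ( [ ¬MY ∘ proj₁ , ¬MN ∘ proj₁ ]′
          , (yi , yi∈ , (Straddles⇒MAW-sep (inj₂ st′) , |x|≤ℓ)
                , proj₂ (Straddles⇒¬MAW st′) ∘ proj₁ , ¬MN ∘ proj₁)
          , inj₁ (Straddles⇒RMℓ _≟_ st |x|≤ℓ))
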